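{- Let $r\ge 1$ be an integer. For every integer $n\ge 0$, \[ D_{r,\mathcal{A}}(n)=\sum_{j=0}^{r-1} b_{r,j}(n)\,D_{r,\mathcal{A}}(j)+g_r(n)\quad\text{in }\mathcal{A}, \] where, for $0\le j\le r-1$, the integers $b_{r,j}(n)$ are defined by $b_{r,j}(n)=\delta_{j,n}$ for $0\le n\le r-1$ and $b_{r,j}(n+r)=\sum_{k=0}^{n}\binom{n}{k}b_{r,j}(k)$ for $n\ge0$, and the integer sequence $(g_r(n))_{n\ge0}$ is defined by $g_r(n)=(-1)^{r-1}\delta_{n,r}$ for $0\le n\le r$ and $g_r(n+r)=\sum_{k=0}^{n}\binom{n}{k}g_r(k)$ for $n\ge 1$.
   Context: $\mathcal{A}\coloneqq\big(\prod_{p\text{ prime}}\mathbb{Z}/p\mathbb{Z}\big)/\big(\bigoplus_{p\text{ prime}}\mathbb{Z}/p\mathbb{Z}\big)$, a $\mathbb{Q}$-algebra via the diagonal embedding of $\mathbb{Q}$ (for the finitely many primes dividing a denominator, the $p$-component is assigned arbitrarily). For integers $r\ge1$, $n\ge0$, $D_{r,\mathcal{A}}(n)\coloneqq\big(\sum_{k=0}^{p-1}\frac{k^n}{(k!)^r}\bmod p\big)_p\in\mathcal{A}$, with the convention $0^0=1$. $\delta$ denotes the Kronecker delta. -}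

module Defs where

open import Data.Nat as ℕ using (ℕ; zero; suc; _∸_; _<_; _<?_; _≟_)
open import Data.Nat.DivMod using (_%_)
open import Data.Nat.Combinatorics using (_C_)
open import Data.Nat.Primality using (Prime)
open import Data.Integer as ℤ using (ℤ; +_; _-_)
import Data.Integer.Divisibility as ℤD
open import Data.Product using (∃; Σ)
open import Relation.Nullary using (yes; no)

sumℕ : ℕ → (ℕ → ℕ) → ℕ
sumℕ zero    f = 0
sumℕ (suc m) f = sumℕ m f ℕ.+ f m

sumℤ : ℕ → (ℕ → ℤ) → ℤ
sumℤ zero    f = + 0
sumℤ (suc m) f = sumℤ m f ℤ.+ f m

factorial : ℕ → ℕ
factorial zero    = 1
factorial (suc n) = suc n ℕ.* factorial n

-- Inverse of a modulo the prime p (Fermat: a^(p-2) mod p); used only for 0 < a, p ∤ a.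
invMod : (p : ℕ) → .{{_ : ℕ.NonZero p}} → ℕ → ℕ
invMod p a = (a ℕ.^ (p ∸ 2)) % p

-- The p-component of D_{r,A}(n): Σ_{k=0}^{p-1} k^n / (k!)^r mod p (as an integer in [0,p)).
-- Note 0^0 = 1 in Data.Nat.
Dcomp : ℕ → ℕ → (p : ℕ) → .{{_ : ℕ.NonZero p}} → ℤ
Dcomp r n p = + (sumℕ p (λ k → (k ℕ.^ n) ℕ.* invMod p (factorial k ℕ.^ r)) % p)

-- An element of A is represented by its components x p (for each p, an integer read mod p;
-- only prime p matter). Two such are equal in A iff they agree mod p for all but finitely many primes p.
_≈𝒜_ : (ℕ → ℤ) → (ℕ → ℤ) → Set
x ≈𝒜 y = ∃ λ N → ∀ p → Prime p → N < p → (+ p) ℤD.∣ (x p - y p)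

-- D_{r,A}(n) as an element of A (value at non-primes p = 0 is irrelevant)
D𝒜 : ℕ → ℕ → (ℕ → ℤ)
D𝒜 r n zero    = + 0
D𝒜 r n (suc q) = Dcomp r n (suc q)

δ : ℕ → ℕ → ℕ
δ i j with i ≟ j
... | yes _ = 1
... | no  _ = 0

-- b_{r,j}(n) with fuel: b(n) = δ_{j,n} for n < r, b(n) = Σ_{k=0}^{n-r} C(n-r,k) b(k) for n ≥ r.
-- Fuel n+1 suffices when r ≥ 1 (recursive calls are on k ≤ n - r < n).
bAux : ℕ → ℕ → ℕ → ℕ → ℕ
bAux zero    r j n = 0
bAux (suc f) r j n with n <? r
... | yes _ = δ j n
... | no  _ = sumℕ (suc (n ∸ r)) (λ k → ((n ∸ r) C k) ℕ.* bAux f r j k)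

b : ℕ → ℕ → ℕ → ℕ
b r j n = bAux (suc n) r j n

sgn : ℕ → ℤ
sgn zero    = + 1
sgn (suc m) = ℤ.- sgn m

gAux : ℕ → ℕ → ℕ → ℤ
gAux zero    r n = + 0
gAux (suc f) r n with r <? n
... | no  _ = sgn (r ∸ 1) ℤ.* (+ δ n r)
... | yes _ = sumℤ (suc (n ∸ r)) (λ k → (+ ((n ∸ r) C k)) ℤ.* gAux f r k)

g : ℕ → ℕ → ℤ
g r n = gAux (suc n) r n

{-# OPTIONS --safe #-}
module Submission where

-- Fix a prime p, let w k ≡ (k!)^(-r) mod p and T n = Σ_{k<p} k^n w k, a lift of the p-component
-- of D_{r,𝒜}(n).  Since k^r w k ≡ w (k-1) for 0 < k < p, shifting the summation index and expanding
-- (j+1)^m binomially gives T (m+r) ≡ Σ_i C(m,i) T i - p^m w (p-1), and by Wilson's theorem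
-- w (p-1) ≡ (-1)^r, so the last term is (-1)^(r-1) δ_{m,0}.  The sequences b_{r,j} and g_r express
-- the solution of exactly this inhomogeneous recurrence through the initial values T 0, …, T (r-1),
-- so strong induction gives the identity modulo every prime.  Fermat's little theorem (for the
-- inverses) comes from the binomial expansion of (x+1)^p, and Wilson's theorem from the alternating
-- sum Σ_k (-1)^k C(n,k) k^e, which vanishes for e < n and equals (-1)^n n! for e = n.

open import Defs
open import Data.Nat using (ℕ; _≤_)
open import Data.Integer using (ℤ; +_; _+_; _*_)
open import Data.Integer as ℤ using (-_; _-_; _^_; 0ℤ; 1ℤ; -1ℤ)
import Data.Integer.Properties as ℤP
open import Data.Integer.Divisibility.Signed
  using (_∣_; divides; ∣m∣n⇒∣m+n; ∣m⇒∣-m; ∣m⇒∣m*n; ∣n⇒∣m*n; ∣ᵤ⇒∣; ∣⇒∣ᵤ)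
open import Data.Integer.Tactic.RingSolver using (solve; solve-∀)
open import Data.List using (_∷_; [])
open import Data.Nat as ℕ using (zero; suc; _<_; _<?_; z≤n; s≤s)
import Data.Nat.Properties as ℕP
import Data.Nat.Tactic.RingSolver as ℕSolver
open import Data.Nat.Combinatorics using (_C_; nCk+nC[k+1]≡[n+1]C[k+1]; nC1≡n; nCn≡1; k>n⇒nCk≡0)
open import Data.Nat.DivMod using (_%_; _/_; m≡m%n+[m/n]*n)
import Data.Nat.Divisibility as ℕD
open import Data.Nat.Divisibility using (_∤_)
open import Data.Nat.Induction using (<-rec)
open import Data.Nat.Primality using (Prime; euclidsLemma)
open import Data.Product using (_,_)
open import Data.Sum using (inj₁; inj₂; [_,_]′)
open import Function using (id)
open import Relation.Binary.Bundles using (Setoid)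
open import Relation.Binary.PropositionalEquality
import Relation.Binary.Reasoning.Setoid as SetoidReasoning
open import Relation.Nullary using (yes; no; contradiction)

sumℤ-cong : ∀ m {f h : ℕ → ℤ} → (∀ k → k < m → f k ≡ h k) → sumℤ m f ≡ sumℤ m h
sumℤ-cong zero    _   = refl
sumℤ-cong (suc m) f≗h =
  cong₂ _+_ (sumℤ-cong m (λ k k<m → f≗h k (ℕP.m<n⇒m<1+n k<m))) (f≗h m (ℕP.n<1+n m))

sumℕ-cong : ∀ m {f h : ℕ → ℕ} → (∀ k → k < m → f k ≡ h k) → sumℕ m f ≡ sumℕ m h
sumℕ-cong zero    _   = refl
sumℕ-cong (suc m) f≗h =
  cong₂ ℕ._+_ (sumℕ-cong m (λ k k<m → f≗h k (ℕP.m<n⇒m<1+n k<m))) (f≗h m (ℕP.n<1+n m))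

sumℤ-zero : ∀ m {f : ℕ → ℤ} → (∀ k → k < m → f k ≡ 0ℤ) → sumℤ m f ≡ 0ℤ
sumℤ-zero zero    _   = refl
sumℤ-zero (suc m) f≗0 =
  cong₂ _+_ (sumℤ-zero m (λ k k<m → f≗0 k (ℕP.m<n⇒m<1+n k<m))) (f≗0 m (ℕP.n<1+n m))

sumℤ-distrib-+ : ∀ m (f h : ℕ → ℤ) → sumℤ m (λ k → f k + h k) ≡ sumℤ m f + sumℤ m h
sumℤ-distrib-+ zero    f h = refl
sumℤ-distrib-+ (suc m) f h = begin
  sumℤ m (λ k → f k + h k) + (f m + h m) ≡⟨ cong (_+ (f m + h m)) (sumℤ-distrib-+ m f h) ⟩
  sumℤ m f + sumℤ m h + (f m + h m)      ≡⟨ interchange (sumℤ m f) (sumℤ m h) (f m) (h m) ⟩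
  sumℤ m f + f m + (sumℤ m h + h m)      ∎
  where
  open ≡-Reasoning
  interchange : ∀ w x y z → w + x + (y + z) ≡ w + y + (x + z)
  interchange = solve-∀

*-distribˡ-sumℤ : ∀ m c (f : ℕ → ℤ) → c * sumℤ m f ≡ sumℤ m (λ k → c * f k)
*-distribˡ-sumℤ zero    c f = ℤP.*-zeroʳ c
*-distribˡ-sumℤ (suc m) c f =
  trans (ℤP.*-distribˡ-+ c (sumℤ m f) (f m)) (cong (_+ c * f m) (*-distribˡ-sumℤ m c f))

*-distribʳ-sumℤ : ∀ m c (f : ℕ → ℤ) → sumℤ m f * c ≡ sumℤ m (λ k → f k * c)
*-distribʳ-sumℤ zero    c f = refl
*-distribʳ-sumℤ (suc m) c f =
  trans (ℤP.*-distribʳ-+ c (sumℤ m f) (f m)) (cong (_+ f m * c) (*-distribʳ-sumℤ m c f))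

sumℤ-head : ∀ m (f : ℕ → ℤ) → sumℤ (suc m) f ≡ f 0 + sumℤ m (λ k → f (suc k))
sumℤ-head zero    f = trans (ℤP.+-identityˡ (f 0)) (sym (ℤP.+-identityʳ (f 0)))
sumℤ-head (suc m) f =
  trans (cong (_+ f (suc m)) (sumℤ-head m f)) (ℤP.+-assoc (f 0) _ (f (suc m)))

sumℤ-comm : ∀ m n (f : ℕ → ℕ → ℤ) →
  sumℤ m (λ i → sumℤ n (λ j → f i j)) ≡ sumℤ n (λ j → sumℤ m (λ i → f i j))
sumℤ-comm zero    n f = sym (sumℤ-zero n (λ _ _ → refl))
sumℤ-comm (suc m) n f = trans (cong (_+ sumℤ n (f m)) (sumℤ-comm m n f))
  (sym (sumℤ-distrib-+ n (λ j → sumℤ m (λ i → f i j)) (f m)))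

pos-sumℕ : ∀ m (f : ℕ → ℕ) → + sumℕ m f ≡ sumℤ m (λ k → + f k)
pos-sumℕ zero    f = refl
pos-sumℕ (suc m) f = trans (ℤP.pos-+ (sumℕ m f) (f m)) (cong (_+ + f m) (pos-sumℕ m f))

pos-^ : ∀ a n → + (a ℕ.^ n) ≡ (+ a) ^ n
pos-^ a zero    = refl
pos-^ a (suc n) = trans (ℤP.pos-* a (a ℕ.^ n)) (cong (+ a *_) (pos-^ a n))

^-distribʳ-* : ∀ x y e → (x ℕ.* y) ℕ.^ e ≡ x ℕ.^ e ℕ.* y ℕ.^ e
^-distribʳ-* x y zero    = refl
^-distribʳ-* x y (suc e) =
  trans (cong (x ℕ.* y ℕ.*_) (^-distribʳ-* x y e)) (interchange x y (x ℕ.^ e) (y ℕ.^ e))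
  where
  interchange : ∀ a c u v → a ℕ.* c ℕ.* (u ℕ.* v) ≡ a ℕ.* u ℕ.* (c ℕ.* v)
  interchange = ℕSolver.solve-∀

δ-refl : ∀ i → δ i i ≡ 1
δ-refl i with i ℕ.≟ i
... | yes _  = refl
... | no i≢i = contradiction refl i≢i

δ-≢ : ∀ {i j} → i ≢ j → δ i j ≡ 0
δ-≢ {i} {j} i≢j with i ℕ.≟ j
... | yes i≡j = contradiction i≡j i≢j
... | no _    = refl

sumℤ-δ : ∀ m n (x : ℕ → ℤ) → n < m → sumℤ m (λ j → + δ j n * x j) ≡ x n
sumℤ-δ (suc m) n x n<1+m with ℕP.m≤n⇒m<n∨m≡n (ℕP.≤-pred n<1+m)
... | inj₁ n<m = begin
  sumℤ m (λ j → + δ j n * x j) + + δ m n * x m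
    ≡⟨ cong₂ _+_ (sumℤ-δ m n x n<m) (cong (λ d → + d * x m) (δ-≢ (ℕP.>⇒≢ n<m))) ⟩
  x n + 0ℤ
    ≡⟨ ℤP.+-identityʳ (x n) ⟩
  x n ∎
  where open ≡-Reasoning
... | inj₂ refl = begin
  sumℤ n (λ j → + δ j n * x j) + + δ n n * x n
    ≡⟨ cong₂ _+_ (sumℤ-zero n off-diagonal) (cong (λ d → + d * x n) (δ-refl n)) ⟩
  0ℤ + 1ℤ * x n
    ≡⟨ trans (ℤP.+-identityˡ _) (ℤP.*-identityˡ (x n)) ⟩
  x n ∎
  where
  open ≡-Reasoning
  off-diagonal : ∀ j → j < n → + δ j n * x j ≡ 0ℤ
  off-diagonal j j<n = cong (λ d → + d * x j) (δ-≢ (ℕP.<⇒≢ j<n))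

[1+k]*[1+n]C[1+k]≡[1+n]*nCk : ∀ n k → suc k ℕ.* (suc n C suc k) ≡ suc n ℕ.* (n C k)
[1+k]*[1+n]C[1+k]≡[1+n]*nCk zero    zero    = refl
[1+k]*[1+n]C[1+k]≡[1+n]*nCk zero    (suc k) = ℕP.*-zeroʳ (suc (suc k))
[1+k]*[1+n]C[1+k]≡[1+n]*nCk (suc n) zero    =
  trans (ℕP.*-identityˡ _) (trans (nC1≡n (suc (suc n))) (sym (ℕP.*-identityʳ _)))
[1+k]*[1+n]C[1+k]≡[1+n]*nCk (suc n) (suc k) = begin
  suc (suc k) ℕ.* (suc (suc n) C suc (suc k))
    ≡⟨ cong (suc (suc k) ℕ.*_) (sym (nCk+nC[k+1]≡[n+1]C[k+1] (suc n) (suc k))) ⟩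
  suc (suc k) ℕ.* (c₀ ℕ.+ c₁)
    ≡⟨ split k c₀ c₁ ⟩
  suc k ℕ.* c₀ ℕ.+ c₀ ℕ.+ suc (suc k) ℕ.* c₁
    ≡⟨ cong₂ (λ u v → u ℕ.+ c₀ ℕ.+ v) ([1+k]*[1+n]C[1+k]≡[1+n]*nCk n k)
                                       ([1+k]*[1+n]C[1+k]≡[1+n]*nCk n (suc k)) ⟩
  suc n ℕ.* (n C k) ℕ.+ c₀ ℕ.+ suc n ℕ.* (n C suc k)
    ≡⟨ merge n (n C k) (n C suc k) c₀ ⟩
  suc n ℕ.* (n C k ℕ.+ n C suc k) ℕ.+ c₀
    ≡⟨ cong (λ u → suc n ℕ.* u ℕ.+ c₀) (nCk+nC[k+1]≡[n+1]C[k+1] n k) ⟩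
  suc n ℕ.* c₀ ℕ.+ c₀
    ≡⟨ ℕP.+-comm (suc n ℕ.* c₀) c₀ ⟩
  suc (suc n) ℕ.* c₀ ∎
  where
  open ≡-Reasoning
  c₀ = suc n C suc k
  c₁ = suc n C suc (suc k)
  split : ∀ k x y → suc (suc k) ℕ.* (x ℕ.+ y) ≡ suc k ℕ.* x ℕ.+ x ℕ.+ suc (suc k) ℕ.* y
  split = ℕSolver.solve-∀
  merge : ∀ n x y z → suc n ℕ.* x ℕ.+ z ℕ.+ suc n ℕ.* y ≡ suc n ℕ.* (x ℕ.+ y) ℕ.+ z
  merge = ℕSolver.solve-∀

binomial : ∀ x m → (1ℤ + x) ^ m ≡ sumℤ (suc m) (λ i → + (m C i) * x ^ i)
binomial x zero    = refl
binomial x (suc m) = sym (begin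
  sumℤ (suc (suc m)) (λ i → + (suc m C i) * x ^ i)
    ≡⟨ sumℤ-head (suc m) _ ⟩
  1ℤ + sumℤ (suc m) (λ i → + (suc m C suc i) * x ^ suc i)
    ≡⟨ cong (λ u → 1ℤ + u) (sumℤ-cong (suc m) (λ i _ → pascal i)) ⟩
  1ℤ + sumℤ (suc m) (λ i → x * t i + t (suc i))
    ≡⟨ cong (λ u → 1ℤ + u) (sumℤ-distrib-+ (suc m) _ _) ⟩
  1ℤ + (sumℤ (suc m) (λ i → x * t i) + R)
    ≡⟨ cong (λ u → 1ℤ + (u + R)) (sym (*-distribˡ-sumℤ (suc m) x t)) ⟩
  1ℤ + (x * S + R)
    ≡⟨ +-comm-inner 1ℤ (x * S) R ⟩
  x * S + (1ℤ + R)
    ≡⟨ cong (λ u → x * S + u) (sym (sumℤ-head (suc m) t)) ⟩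
  x * S + (S + t (suc m))
    ≡⟨ cong (λ c → x * S + (S + + c * x ^ suc m)) (k>n⇒nCk≡0 (ℕP.n<1+n m)) ⟩
  x * S + (S + 0ℤ)
    ≡⟨ collect x S ⟩
  (1ℤ + x) * S
    ≡⟨ cong ((1ℤ + x) *_) (sym (binomial x m)) ⟩
  (1ℤ + x) ^ suc m ∎)
  where
  open ≡-Reasoning
  t : ℕ → ℤ
  t i = + (m C i) * x ^ i
  S = sumℤ (suc m) t
  R = sumℤ (suc m) (λ i → t (suc i))
  pascal : ∀ i → + (suc m C suc i) * x ^ suc i ≡ x * t i + t (suc i)
  pascal i = begin
    + (suc m C suc i) * x ^ suc i
      ≡⟨ cong (λ c → + c * x ^ suc i) (sym (nCk+nC[k+1]≡[n+1]C[k+1] m i)) ⟩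
    + (m C i ℕ.+ m C suc i) * x ^ suc i
      ≡⟨ cong (_* x ^ suc i) (ℤP.pos-+ (m C i) (m C suc i)) ⟩
    (+ (m C i) + + (m C suc i)) * (x * x ^ i)
      ≡⟨ distrib (+ (m C i)) (+ (m C suc i)) x (x ^ i) ⟩
    x * t i + t (suc i) ∎
    where
    open ≡-Reasoning
    distrib : ∀ c d x y → (c + d) * (x * y) ≡ x * (c * y) + d * (x * y)
    distrib = solve-∀
  +-comm-inner : ∀ a u v → a + (u + v) ≡ u + (a + v)
  +-comm-inner = solve-∀
  collect : ∀ x s → x * s + (s + 0ℤ) ≡ (1ℤ + x) * s
  collect = solve-∀

sumℤ-shifted-powers : ∀ N m (w : ℕ → ℤ) →
  sumℤ N (λ j → (+ suc j) ^ m * w j) ≡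
  sumℤ (suc m) (λ i → + (m C i) * sumℤ N (λ j → (+ j) ^ i * w j))
sumℤ-shifted-powers N m w = begin
  sumℤ N (λ j → (1ℤ + + j) ^ m * w j)
    ≡⟨ sumℤ-cong N (λ j _ → expand j) ⟩
  sumℤ N (λ j → sumℤ (suc m) (λ i → + (m C i) * ((+ j) ^ i * w j)))
    ≡⟨ sumℤ-comm N (suc m) _ ⟩
  sumℤ (suc m) (λ i → sumℤ N (λ j → + (m C i) * ((+ j) ^ i * w j)))
    ≡⟨ sumℤ-cong (suc m) (λ i _ → *-distribˡ-sumℤ N (+ (m C i)) _) ⟨
  sumℤ (suc m) (λ i → + (m C i) * sumℤ N (λ j → (+ j) ^ i * w j)) ∎
  where
  open ≡-Reasoning
  expand : ∀ j → (1ℤ + + j) ^ m * w j ≡ sumℤ (suc m) (λ i → + (m C i) * ((+ j) ^ i * w j))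
  expand j = trans (cong (_* w j) (binomial (+ j) m)) (trans (*-distribʳ-sumℤ (suc m) (w j) _)
    (sumℤ-cong (suc m) (λ i _ → ℤP.*-assoc (+ (m C i)) ((+ j) ^ i) (w j))))

module Congruence (m : ℤ) where

  -- A record rather than a definition, so that x and y can be inferred from a proof.
  infix 4 _≋_
  record _≋_ (x y : ℤ) : Set where
    constructor ≋-intro
    field
      divides-difference : m ∣ x - y
  open _≋_ public

  ∣⇒≋ : ∀ {x y d} → m ∣ d → d ≡ x - y → x ≋ y
  ∣⇒≋ m∣d refl = ≋-intro m∣d

  ≋-reflexive : ∀ {x y} → x ≡ y → x ≋ y
  ≋-reflexive {x} refl = ∣⇒≋ (divides 0ℤ refl) (sym (ℤP.+-inverseʳ x))

  ≋-refl : ∀ {x} → x ≋ x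
  ≋-refl = ≋-reflexive refl

  ≋-sym : ∀ {x y} → x ≋ y → y ≋ x
  ≋-sym {x} {y} (≋-intro m∣x-y) = ∣⇒≋ (∣m⇒∣-m m∣x-y) (solve (x ∷ y ∷ []))

  ≋-trans : ∀ {x y z} → x ≋ y → y ≋ z → x ≋ z
  ≋-trans {x} {y} {z} (≋-intro m∣x-y) (≋-intro m∣y-z) =
    ∣⇒≋ (∣m∣n⇒∣m+n m∣x-y m∣y-z) (solve (x ∷ y ∷ z ∷ []))

  ≋-setoid : Setoid _ _
  ≋-setoid = record
    { Carrier = ℤ ; _≈_ = _≋_
    ; isEquivalence = record { refl = ≋-refl ; sym = ≋-sym ; trans = ≋-trans } }

  module ≋-Reasoning = SetoidReasoning ≋-setoid

  +-cong : ∀ {x y u v} → x ≋ y → u ≋ v → x + u ≋ y + v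
  +-cong {x} {y} {u} {v} (≋-intro m∣x-y) (≋-intro m∣u-v) =
    ∣⇒≋ (∣m∣n⇒∣m+n m∣x-y m∣u-v) (solve (x ∷ y ∷ u ∷ v ∷ []))

  *-cong : ∀ {x y u v} → x ≋ y → u ≋ v → x * u ≋ y * v
  *-cong {x} {y} {u} {v} (≋-intro m∣x-y) (≋-intro m∣u-v) =
    ∣⇒≋ (∣m∣n⇒∣m+n (∣m⇒∣m*n u m∣x-y) (∣n⇒∣m*n y m∣u-v))
         (solve (x ∷ y ∷ u ∷ v ∷ []))

  -‿cong : ∀ {x y} → x ≋ y → - x ≋ - y
  -‿cong {x} {y} (≋-intro m∣x-y) = ∣⇒≋ (∣m⇒∣-m m∣x-y) (solve (x ∷ y ∷ []))

  ^-congˡ : ∀ {x y} n → x ≋ y → x ^ n ≋ y ^ n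
  ^-congˡ zero    _   = ≋-refl
  ^-congˡ (suc n) x≋y = *-cong x≋y (^-congˡ n x≋y)

  +-congˡ : ∀ z {x y} → x ≋ y → z + x ≋ z + y
  +-congˡ z = +-cong (≋-refl {z})

  +-congʳ : ∀ z {x y} → x ≋ y → x + z ≋ y + z
  +-congʳ z x≋y = +-cong x≋y (≋-refl {z})

  *-congˡ : ∀ z {x y} → x ≋ y → z * x ≋ z * y
  *-congˡ z = *-cong (≋-refl {z})

  *-congʳ : ∀ z {x y} → x ≋ y → x * z ≋ y * z
  *-congʳ z x≋y = *-cong x≋y (≋-refl {z})

  sumℤ-cong-≋ : ∀ n {f h : ℕ → ℤ} → (∀ k → k < n → f k ≋ h k) → sumℤ n f ≋ sumℤ n h
  sumℤ-cong-≋ zero    _   = ≋-refl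
  sumℤ-cong-≋ (suc n) f≋h =
    +-cong (sumℤ-cong-≋ n (λ k k<n → f≋h k (ℕP.m<n⇒m<1+n k<n))) (f≋h n (ℕP.n<1+n n))

  multiple≋0 : ∀ k → k * m ≋ 0ℤ
  multiple≋0 k = ∣⇒≋ (divides k refl) (sym (ℤP.+-identityʳ (k * m)))

  inverse-unique : ∀ {x u v} → x * u ≋ 1ℤ → x * v ≋ 1ℤ → u ≋ v
  inverse-unique {x} {u} {v} xu≋1 xv≋1 = begin
    u            ≡⟨ solve (u ∷ []) ⟩
    u * 1ℤ       ≈⟨ *-congˡ u (≋-sym xv≋1) ⟩
    u * (x * v)  ≡⟨ solve (u ∷ x ∷ v ∷ []) ⟩
    (x * u) * v  ≈⟨ *-congʳ v xu≋1 ⟩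
    1ℤ * v       ≡⟨ ℤP.*-identityˡ v ⟩
    v            ∎
    where open ≋-Reasoning

-- With this term the recurrence of g_r holds for every m ≥ 0, not only for m ≥ 1.
forcing : ℕ → ℕ → ℤ
forcing r zero    = sgn (r ℕ.∸ 1)
forcing r (suc _) = 0ℤ

module Unfolding (r' : ℕ) where

  private
    r : ℕ
    r = suc r'

    fuel-suffices : ∀ {i k f} → r ≤ k → i ≤ k ℕ.∸ r → k < suc f → i < f
    fuel-suffices {k = suc k} (s≤s _) i≤k∸r (s≤s k<f) =
      ℕP.≤-<-trans (ℕP.≤-trans i≤k∸r (ℕP.m∸n≤m k r')) k<f

  bAux-fuel : ∀ f f' j k → k < f → k < f' → bAux f r j k ≡ bAux f' r j k
  bAux-fuel (suc f) (suc f') j k k<f k<f' with k <? r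
  ... | yes _   = refl
  ... | no k≮r  = sumℕ-cong (suc (k ℕ.∸ r)) λ i i≤k∸r → cong (((k ℕ.∸ r) C i) ℕ.*_)
    (bAux-fuel f f' j i (fuel-suffices (ℕP.≮⇒≥ k≮r) (ℕP.≤-pred i≤k∸r) k<f)
                        (fuel-suffices (ℕP.≮⇒≥ k≮r) (ℕP.≤-pred i≤k∸r) k<f'))

  gAux-fuel : ∀ f f' k → k < f → k < f' → gAux f r k ≡ gAux f' r k
  gAux-fuel (suc f) (suc f') k k<f k<f' with r <? k
  ... | no _    = refl
  ... | yes r<k = sumℤ-cong (suc (k ℕ.∸ r)) λ i i≤k∸r → cong (+ ((k ℕ.∸ r) C i) *_)
    (gAux-fuel f f' i (fuel-suffices (ℕP.<⇒≤ r<k) (ℕP.≤-pred i≤k∸r) k<f)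
                      (fuel-suffices (ℕP.<⇒≤ r<k) (ℕP.≤-pred i≤k∸r) k<f'))

  private
    <-+r : ∀ {k m} → k < suc m → k < m ℕ.+ r
    <-+r {k} {m} k<1+m = ℕP.≤-<-trans (ℕP.≤-pred k<1+m) (ℕP.m<m+n m (s≤s z≤n))

  b-initial : ∀ j n → n < r → b r j n ≡ δ j n
  b-initial j n n<r with n <? r
  ... | yes _   = refl
  ... | no n≮r  = contradiction n<r n≮r

  b-recurrence : ∀ j m → b r j (m ℕ.+ r) ≡ sumℕ (suc m) (λ k → (m C k) ℕ.* b r j k)
  b-recurrence j m with m ℕ.+ r <? r
  ... | yes m+r<r = contradiction m+r<r (ℕP.≤⇒≯ (ℕP.m≤n+m r m))
  ... | no _ rewrite ℕP.m+n∸n≡m m r = sumℕ-cong (suc m) λ k k≤m →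
    cong ((m C k) ℕ.*_) (bAux-fuel (m ℕ.+ r) (suc k) j k (<-+r k≤m) (ℕP.n<1+n k))

  g-initial : ∀ n → n < r → g r n ≡ 0ℤ
  g-initial n n<r with r <? n
  ... | yes r<n = contradiction r<n (ℕP.<⇒≯ n<r)
  ... | no _    = trans (cong (λ d → sgn r' * + d) (δ-≢ (ℕP.<⇒≢ n<r))) (ℤP.*-zeroʳ (sgn r'))

  g-recurrence : ∀ m → g r (m ℕ.+ r) ≡ sumℤ (suc m) (λ k → + (m C k) * g r k) + forcing r m
  g-recurrence zero with r <? r
  ... | yes r<r = contradiction r<r (ℕP.<-irrefl refl)
  ... | no _    = begin
    sgn r' * + δ r r        ≡⟨ cong (λ d → sgn r' * + d) (δ-refl r) ⟩
    sgn r' * 1ℤ             ≡⟨ ℤP.*-identityʳ (sgn r') ⟩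
    sgn r'                  ≡⟨ ℤP.+-identityˡ (sgn r') ⟨
    0ℤ + sgn r'             ≡⟨ cong (λ v → 0ℤ + (1ℤ * v) + sgn r') (g-initial 0 (s≤s z≤n)) ⟨
    0ℤ + 1ℤ * g r 0 + sgn r' ∎
    where open ≡-Reasoning
  g-recurrence (suc m) with r <? suc m ℕ.+ r
  ... | no r≮m+r = contradiction (ℕP.m<n+m r (s≤s z≤n)) r≮m+r
  ... | yes _ rewrite ℕP.m+n∸n≡m (suc m) r = trans
    (sumℤ-cong (suc (suc m)) λ k k≤1+m →
      cong (+ (suc m C k) *_) (gAux-fuel (suc m ℕ.+ r) (suc k) k (<-+r k≤1+m) (ℕP.n<1+n k)))
    (sym (ℤP.+-identityʳ _))

  b-recurrence-sumℤ : ∀ m (x : ℕ → ℤ) →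
    sumℤ (suc m) (λ i → + (m C i) * sumℤ r (λ j → + b r j i * x j)) ≡
    sumℤ r (λ j → + b r j (m ℕ.+ r) * x j)
  b-recurrence-sumℤ m x = begin
    sumℤ (suc m) (λ i → + (m C i) * sumℤ r (λ j → + b r j i * x j))
      ≡⟨ sumℤ-cong (suc m) (λ i _ → *-distribˡ-sumℤ r (+ (m C i)) _) ⟩
    sumℤ (suc m) (λ i → sumℤ r (λ j → + (m C i) * (+ b r j i * x j)))
      ≡⟨ sumℤ-comm (suc m) r _ ⟩
    sumℤ r (λ j → sumℤ (suc m) (λ i → + (m C i) * (+ b r j i * x j)))
      ≡⟨ sumℤ-cong r (λ j _ → column j) ⟨
    sumℤ r (λ j → + b r j (m ℕ.+ r) * x j) ∎
    where
    open ≡-Reasoning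
    column : ∀ j → + b r j (m ℕ.+ r) * x j ≡ sumℤ (suc m) (λ i → + (m C i) * (+ b r j i * x j))
    column j = begin
      + b r j (m ℕ.+ r) * x j
        ≡⟨ cong (λ v → + v * x j) (b-recurrence j m) ⟩
      + sumℕ (suc m) (λ i → (m C i) ℕ.* b r j i) * x j
        ≡⟨ cong (_* x j) (pos-sumℕ (suc m) _) ⟩
      sumℤ (suc m) (λ i → + ((m C i) ℕ.* b r j i)) * x j
        ≡⟨ *-distribʳ-sumℤ (suc m) (x j) _ ⟩
      sumℤ (suc m) (λ i → + ((m C i) ℕ.* b r j i) * x j)
        ≡⟨ sumℤ-cong (suc m) (λ i _ → cast-assoc i) ⟩
      sumℤ (suc m) (λ i → + (m C i) * (+ b r j i * x j)) ∎
      where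
      cast-assoc : ∀ i → + ((m C i) ℕ.* b r j i) * x j ≡ + (m C i) * (+ b r j i * x j)
      cast-assoc i = trans (cong (_* x j) (ℤP.pos-* (m C i) (b r j i)))
                           (ℤP.*-assoc (+ (m C i)) (+ b r j i) (x j))

module Recurrence (modulus : ℤ) (r' : ℕ) (T : ℕ → ℤ) where

  private
    r : ℕ
    r = suc r'
  open Congruence modulus
  open Unfolding r'
  open ≋-Reasoning

  Represented : ℕ → Set
  Represented n = T n ≋ sumℤ r (λ j → + b r j n * T j) + g r n

  represented-initial : ∀ n → n < r → Represented n
  represented-initial n n<r = begin
    T n
      ≡⟨ sumℤ-δ r n T n<r ⟨
    sumℤ r (λ j → + δ j n * T j)
      ≡⟨ sumℤ-cong r (λ j _ → cong (λ d → + d * T j) (b-initial j n n<r)) ⟨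
    sumℤ r (λ j → + b r j n * T j)
      ≡⟨ ℤP.+-identityʳ _ ⟨
    sumℤ r (λ j → + b r j n * T j) + 0ℤ
      ≡⟨ cong (λ v → sumℤ r (λ j → + b r j n * T j) + v) (g-initial n n<r) ⟨
    sumℤ r (λ j → + b r j n * T j) + g r n ∎

  module _
    (T-recurrence : ∀ m → T (m ℕ.+ r) ≋ sumℤ (suc m) (λ i → + (m C i) * T i) + forcing r m)
    where

    represented-step : ∀ m → (∀ i → i < suc m → Represented i) → Represented (m ℕ.+ r)
    represented-step m IH = begin
      T (m ℕ.+ r)
        ≈⟨ T-recurrence m ⟩
      sumℤ (suc m) (λ i → + (m C i) * T i) + forcing r m
        ≈⟨ +-congʳ (forcing r m) (sumℤ-cong-≋ (suc m) λ i i≤m → *-congˡ (+ (m C i)) (IH i i≤m)) ⟩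
      sumℤ (suc m) (λ i → + (m C i) * (B i + g r i)) + forcing r m
        ≡⟨ cong (_+ forcing r m) (sumℤ-cong (suc m) λ i _ → ℤP.*-distribˡ-+ (+ (m C i)) (B i) (g r i)) ⟩
      sumℤ (suc m) (λ i → + (m C i) * B i + + (m C i) * g r i) + forcing r m
        ≡⟨ cong (_+ forcing r m) (sumℤ-distrib-+ (suc m) _ _) ⟩
      sumℤ (suc m) (λ i → + (m C i) * B i) + sumℤ (suc m) (λ i → + (m C i) * g r i) + forcing r m
        ≡⟨ ℤP.+-assoc (sumℤ (suc m) (λ i → + (m C i) * B i)) _ _ ⟩
      sumℤ (suc m) (λ i → + (m C i) * B i) + (sumℤ (suc m) (λ i → + (m C i) * g r i) + forcing r m)
        ≡⟨ cong₂ _+_ (b-recurrence-sumℤ m T) (sym (g-recurrence m)) ⟩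
      sumℤ r (λ j → + b r j (m ℕ.+ r) * T j) + g r (m ℕ.+ r) ∎
      where
      B : ℕ → ℤ
      B i = sumℤ r (λ j → + b r j i * T j)

    represented : ∀ n → Represented n
    represented = <-rec Represented from-smaller
      where
      from-smaller : ∀ n → (∀ {i} → i < n → Represented i) → Represented n
      from-smaller n rec with ℕP.≤-<-connex r n
      ... | inj₂ n<r = represented-initial n n<r
      ... | inj₁ r≤n = subst Represented (ℕP.m∸n+n≡m r≤n)
        (represented-step (n ℕ.∸ r) λ i i≤n∸r → rec (ℕP.≤-<-trans (ℕP.≤-pred i≤n∸r) n∸r<n))
        where n∸r<n = ℕP.∸-monoʳ-< {n} {r} {0} (s≤s z≤n) r≤n

sgn≡-1^ : ∀ k → sgn k ≡ -1ℤ ^ k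
sgn≡-1^ zero    = refl
sgn≡-1^ (suc k) = trans (cong -_ (sgn≡-1^ k)) (sym (ℤP.-1*i≡-i (-1ℤ ^ k)))

sgn*sgn≡1 : ∀ k → sgn k * sgn k ≡ 1ℤ
sgn*sgn≡1 zero    = refl
sgn*sgn≡1 (suc k) = trans (neg*neg (sgn k)) (sgn*sgn≡1 k)
  where
  neg*neg : ∀ s → - s * - s ≡ s * s
  neg*neg = solve-∀

alternatingMoment : ℕ → ℕ → ℤ
alternatingMoment n e = sumℤ (suc n) (λ k → sgn k * (+ (n C k) * (+ k) ^ e))

alternatingMoment-suc : ∀ n e → alternatingMoment (suc n) (suc e) ≡
  - (+ suc n) * sumℤ (suc e) (λ i → + (e C i) * alternatingMoment n i)
alternatingMoment-suc n e = begin
  sumℤ (suc (suc n)) (λ k → sgn k * (+ (suc n C k) * (+ k) ^ suc e))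
    ≡⟨ sumℤ-head (suc n) _ ⟩
  0ℤ + sumℤ (suc n) (λ j → sgn (suc j) * (+ (suc n C suc j) * (+ suc j) ^ suc e))
    ≡⟨ ℤP.+-identityˡ _ ⟩
  sumℤ (suc n) (λ j → sgn (suc j) * (+ (suc n C suc j) * (+ suc j) ^ suc e))
    ≡⟨ sumℤ-cong (suc n) (λ j _ → term j) ⟩
  sumℤ (suc n) (λ j → - (+ suc n) * sumℤ (suc e) (λ i → t i j))
    ≡⟨ *-distribˡ-sumℤ (suc n) (- (+ suc n)) _ ⟨
  - (+ suc n) * sumℤ (suc n) (λ j → sumℤ (suc e) (λ i → t i j))
    ≡⟨ cong (- (+ suc n) *_) (sumℤ-comm (suc n) (suc e) _) ⟩
  - (+ suc n) * sumℤ (suc e) (λ i → sumℤ (suc n) (λ j → t i j))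
    ≡⟨ cong (- (+ suc n) *_) (sumℤ-cong (suc e) λ i _ → *-distribˡ-sumℤ (suc n) (+ (e C i)) _) ⟨
  - (+ suc n) * sumℤ (suc e) (λ i → + (e C i) * alternatingMoment n i) ∎
  where
  open ≡-Reasoning
  t : ℕ → ℕ → ℤ
  t i j = + (e C i) * (sgn j * (+ (n C j) * (+ j) ^ i))
  term : ∀ j → sgn (suc j) * (+ (suc n C suc j) * (+ suc j) ^ suc e) ≡
               - (+ suc n) * sumℤ (suc e) (λ i → t i j)
  term j = begin
    - sgn j * (+ (suc n C suc j) * (+ suc j * (+ suc j) ^ e))
      ≡⟨ regroup (sgn j) (+ (suc n C suc j)) (+ suc j) ((+ suc j) ^ e) ⟩
    - sgn j * ((+ suc j * + (suc n C suc j)) * (+ suc j) ^ e)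
      ≡⟨ cong₂ (λ u v → - sgn j * (u * v)) absorb (binomial (+ j) e) ⟩
    - sgn j * ((+ suc n * + (n C j)) * sumℤ (suc e) (λ i → + (e C i) * (+ j) ^ i))
      ≡⟨ pull-out (sgn j) (+ suc n) (+ (n C j)) _ ⟩
    - (+ suc n) * ((sgn j * + (n C j)) * sumℤ (suc e) (λ i → + (e C i) * (+ j) ^ i))
      ≡⟨ cong (- (+ suc n) *_) (*-distribˡ-sumℤ (suc e) (sgn j * + (n C j)) _) ⟩
    - (+ suc n) * sumℤ (suc e) (λ i → (sgn j * + (n C j)) * (+ (e C i) * (+ j) ^ i))
      ≡⟨ cong (- (+ suc n) *_) (sumℤ-cong (suc e) λ i _ → reorder (sgn j) (+ (n C j)) (+ (e C i)) _) ⟩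
    - (+ suc n) * sumℤ (suc e) (λ i → t i j) ∎
    where
    absorb : + suc j * + (suc n C suc j) ≡ + suc n * + (n C j)
    absorb = trans (sym (ℤP.pos-* (suc j) _))
                   (trans (cong +_ ([1+k]*[1+n]C[1+k]≡[1+n]*nCk n j)) (ℤP.pos-* (suc n) _))
    regroup : ∀ s c x y → - s * (c * (x * y)) ≡ - s * ((x * c) * y)
    regroup = solve-∀
    pull-out : ∀ s a c y → - s * ((a * c) * y) ≡ - a * ((s * c) * y)
    pull-out = solve-∀
    reorder : ∀ s c d y → (s * c) * (d * y) ≡ d * (s * (c * y))
    reorder = solve-∀

alternatingMoment-below : ∀ n e → e < n → alternatingMoment n e ≡ 0ℤ
alternatingMoment-below (suc n) zero    _ = begin
  sumℤ (suc (suc n)) (λ k → sgn k * (+ (suc n C k) * 1ℤ))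
    ≡⟨ sumℤ-cong (suc (suc n)) (λ k _ → signed-term k) ⟩
  sumℤ (suc (suc n)) (λ k → + (suc n C k) * -1ℤ ^ k)
    ≡⟨ binomial -1ℤ (suc n) ⟨
  0ℤ ^ suc n
    ≡⟨⟩
  0ℤ ∎
  where
  open ≡-Reasoning
  signed-term : ∀ k → sgn k * (+ (suc n C k) * 1ℤ) ≡ + (suc n C k) * -1ℤ ^ k
  signed-term k = trans (cong (_* (+ (suc n C k) * 1ℤ)) (sgn≡-1^ k)) (commute (+ (suc n C k)) (-1ℤ ^ k))
    where
    commute : ∀ c s → s * (c * 1ℤ) ≡ c * s
    commute = solve-∀
alternatingMoment-below (suc n) (suc e) (s≤s e<n) = begin
  alternatingMoment (suc n) (suc e)
    ≡⟨ alternatingMoment-suc n e ⟩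
  - (+ suc n) * sumℤ (suc e) (λ i → + (e C i) * alternatingMoment n i)
    ≡⟨ cong (- (+ suc n) *_) (sumℤ-zero (suc e) vanish) ⟩
  - (+ suc n) * 0ℤ
    ≡⟨ ℤP.*-zeroʳ (- (+ suc n)) ⟩
  0ℤ ∎
  where
  open ≡-Reasoning
  vanish : ∀ i → i < suc e → + (e C i) * alternatingMoment n i ≡ 0ℤ
  vanish i i≤e = trans
    (cong (+ (e C i) *_) (alternatingMoment-below n i (ℕP.≤-<-trans (ℕP.≤-pred i≤e) e<n)))
    (ℤP.*-zeroʳ (+ (e C i)))

alternatingMoment-diagonal : ∀ n → alternatingMoment n n ≡ sgn n * + factorial n
alternatingMoment-diagonal zero    = refl
alternatingMoment-diagonal (suc n) = begin
  alternatingMoment (suc n) (suc n)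
    ≡⟨ alternatingMoment-suc n n ⟩
  - (+ suc n) * (sumℤ n (λ i → + (n C i) * alternatingMoment n i) + + (n C n) * alternatingMoment n n)
    ≡⟨ cong₂ (λ u v → - (+ suc n) * (u + v)) (sumℤ-zero n vanish)
             (cong₂ (λ c v → + c * v) (nCn≡1 n) (alternatingMoment-diagonal n)) ⟩
  - (+ suc n) * (0ℤ + 1ℤ * (sgn n * + factorial n))
    ≡⟨ regroup (+ suc n) (sgn n) (+ factorial n) ⟩
  - sgn n * (+ suc n * + factorial n)
    ≡⟨ cong (- sgn n *_) (ℤP.pos-* (suc n) (factorial n)) ⟨
  sgn (suc n) * + factorial (suc n) ∎
  where
  open ≡-Reasoning
  vanish : ∀ i → i < n → + (n C i) * alternatingMoment n i ≡ 0ℤ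
  vanish i i<n = trans (cong (+ (n C i) *_) (alternatingMoment-below n i i<n)) (ℤP.*-zeroʳ (+ (n C i)))
  regroup : ∀ a s f → - a * (0ℤ + 1ℤ * (s * f)) ≡ - s * (a * f)
  regroup = solve-∀

module NatCongruence (d : ℕ) .{{_ : ℕ.NonZero d}} where
  open Congruence (+ d) public

  %-≋ : ∀ x → + (x % d) ≋ + x
  %-≋ x = ≋-sym (∣⇒≋ (divides (+ (x / d)) refl) (begin
    + (x / d) * + d
      ≡⟨ ℤP.pos-* (x / d) d ⟨
    + (x / d ℕ.* d)
      ≡⟨ add-sub (+ (x % d)) _ ⟩
    + (x % d) + + (x / d ℕ.* d) - + (x % d)
      ≡⟨ cong (_- + (x % d)) (ℤP.pos-+ (x % d) _) ⟨
    + (x % d ℕ.+ x / d ℕ.* d) - + (x % d)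
      ≡⟨ cong (λ y → + y - + (x % d)) (m≡m%n+[m/n]*n x d) ⟨
    + x - + (x % d) ∎))
    where
    open ≡-Reasoning
    add-sub : ∀ a y → y ≡ a + y - a
    add-sub = solve-∀

  ℕ∣⇒≋0 : ∀ {c} → d ℕD.∣ c → + c ≋ 0ℤ
  ℕ∣⇒≋0 {c} d∣c = ∣⇒≋ (∣ᵤ⇒∣ d∣c) (sym (ℤP.+-identityʳ (+ c)))

module PrimeModulus (q : ℕ) (p-prime : Prime (suc (suc q))) where

  private
    p : ℕ
    p = suc (suc q)
  open NatCongruence p public
  open ≋-Reasoning

  ∤-* : ∀ {x y} → p ∤ x → p ∤ y → p ∤ x ℕ.* y
  ∤-* {x} {y} p∤x p∤y p∣xy = [ p∤x , p∤y ]′ (euclidsLemma x y p-prime p∣xy)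

  ∤-1 : p ∤ 1
  ∤-1 = ℕD.>⇒∤ (s≤s (s≤s z≤n))

  ∤-^ : ∀ {x} e → p ∤ x → p ∤ x ℕ.^ e
  ∤-^ zero    _   = ∤-1
  ∤-^ (suc e) p∤x = ∤-* p∤x (∤-^ e p∤x)

  ∤-factorial : ∀ k → k < p → p ∤ factorial k
  ∤-factorial zero    _     = ∤-1
  ∤-factorial (suc k) 1+k<p =
    ∤-* (ℕD.>⇒∤ 1+k<p) (∤-factorial k (ℕP.<-trans (ℕP.n<1+n k) 1+k<p))

  p∣pC[1+i] : ∀ i → suc i < p → p ℕD.∣ p C suc i
  p∣pC[1+i] i 1+i<p = [ (λ p∣1+i → contradiction p∣1+i (ℕD.>⇒∤ 1+i<p)) , id ]′
    (euclidsLemma (suc i) (p C suc i) p-prime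
      (subst (p ℕD.∣_) (sym ([1+k]*[1+n]C[1+k]≡[1+n]*nCk (suc q) i)) (ℕD.m∣m*n (suc q C i))))

  *-cancelˡ-≋ : ∀ {x y z} → p ∤ x → + x * y ≋ + x * z → y ≋ z
  *-cancelˡ-≋ {x} {y} {z} p∤x (≋-intro p∣xy-xz) =
    [ (λ p∣x → contradiction p∣x p∤x) , (λ p∣y-z → ≋-intro (∣ᵤ⇒∣ p∣y-z)) ]′
      (euclidsLemma x ℤ.∣ y - z ∣ p-prime p∣x∣y-z∣)
    where
    factor : ∀ a u v → a * u - a * v ≡ a * (u - v)
    factor = solve-∀
    p∣x∣y-z∣ : p ℕD.∣ x ℕ.* ℤ.∣ y - z ∣
    p∣x∣y-z∣ = subst (p ℕD.∣_) (ℤP.abs-* (+ x) (y - z))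
      (∣⇒∣ᵤ (subst (+ p ∣_) (factor (+ x) y z) p∣xy-xz))

  frobenius : ∀ x → (+ x) ^ p ≋ + x
  frobenius zero    = ≋-refl
  frobenius (suc x) = begin
    (1ℤ + + x) ^ p
      ≡⟨ binomial (+ x) p ⟩
    sumℤ (suc p) t
      ≡⟨ sumℤ-head p t ⟩
    1ℤ + (sumℤ (suc q) (λ i → t (suc i)) + + (p C p) * (+ x) ^ p)
      ≈⟨ +-congˡ 1ℤ (+-congʳ (+ (p C p) * (+ x) ^ p) inner-terms) ⟩
    1ℤ + (0ℤ + + (p C p) * (+ x) ^ p)
      ≡⟨ cong (λ c → 1ℤ + (0ℤ + + c * (+ x) ^ p)) (nCn≡1 p) ⟩
    1ℤ + (0ℤ + 1ℤ * (+ x) ^ p)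
      ≡⟨ cong (λ y → 1ℤ + y) (trans (ℤP.+-identityˡ (1ℤ * (+ x) ^ p)) (ℤP.*-identityˡ ((+ x) ^ p))) ⟩
    1ℤ + (+ x) ^ p
      ≈⟨ +-congˡ 1ℤ (frobenius x) ⟩
    1ℤ + + x ∎
    where
    t : ℕ → ℤ
    t i = + (p C i) * (+ x) ^ i
    inner-terms : sumℤ (suc q) (λ i → t (suc i)) ≋ 0ℤ
    inner-terms = begin
      sumℤ (suc q) (λ i → t (suc i))
        ≈⟨ sumℤ-cong-≋ (suc q) (λ i i<1+q → *-congʳ ((+ x) ^ suc i) (ℕ∣⇒≋0 (p∣pC[1+i] i (s≤s i<1+q)))) ⟩
      sumℤ (suc q) (λ i → 0ℤ * (+ x) ^ suc i)
        ≡⟨ sumℤ-zero (suc q) (λ _ _ → refl) ⟩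
      0ℤ ∎

  fermat : ∀ {x} → p ∤ x → (+ x) ^ suc q ≋ 1ℤ
  fermat {x} p∤x = *-cancelˡ-≋ p∤x (begin
    (+ x) ^ p     ≈⟨ frobenius x ⟩
    + x           ≡⟨ ℤP.*-identityʳ (+ x) ⟨
    + x * 1ℤ      ∎)

  invMod-inverse : ∀ {x} → p ∤ x → + x * + invMod p x ≋ 1ℤ
  invMod-inverse {x} p∤x = begin
    + x * + ((x ℕ.^ q) % p)    ≈⟨ *-congˡ (+ x) (%-≋ (x ℕ.^ q)) ⟩
    + x * + (x ℕ.^ q)          ≡⟨ cong (+ x *_) (pos-^ x q) ⟩
    (+ x) ^ suc q              ≈⟨ fermat p∤x ⟩
    1ℤ                         ∎

  wilson : + factorial (suc q) ≋ -1ℤ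
  wilson = begin
    + factorial n
      ≡⟨ ℤP.*-identityˡ _ ⟨
    1ℤ * + factorial n
      ≈⟨ *-congʳ (+ factorial n) (≋-sym sgn≋1) ⟩
    sgn n * + factorial n
      ≡⟨ alternatingMoment-diagonal n ⟨
    alternatingMoment n n
      ≡⟨ sumℤ-head n _ ⟩
    0ℤ + sumℤ n (λ j → sgn (suc j) * (+ (n C suc j) * (+ suc j) ^ n))
      ≈⟨ +-congˡ 0ℤ (sumℤ-cong-≋ n λ j j<n →
           *-congˡ (sgn (suc j)) (*-congˡ (+ (n C suc j)) (fermat (ℕD.>⇒∤ (s≤s j<n))))) ⟩
    0ℤ + sumℤ n (λ j → sgn (suc j) * (+ (n C suc j) * 1ℤ))
      ≡⟨ ℤP.+-identityˡ _ ⟩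
    sumℤ n (λ j → sgn (suc j) * (+ (n C suc j) * 1ℤ))
      ≡⟨ add-sub _ ⟩
    1ℤ + sumℤ n (λ j → sgn (suc j) * (+ (n C suc j) * 1ℤ)) - 1ℤ
      ≡⟨ cong (_- 1ℤ) (sumℤ-head n _) ⟨
    alternatingMoment n 0 - 1ℤ
      ≡⟨ cong (_- 1ℤ) (alternatingMoment-below n 0 (s≤s z≤n)) ⟩
    -1ℤ ∎
    where
    n = suc q
    add-sub : ∀ y → y ≡ 1ℤ + y - 1ℤ
    add-sub = solve-∀
    -1≋n : -1ℤ ≋ + n
    -1≋n = ∣⇒≋ (divides -1ℤ refl) (ℤP.-1*i≡-i (+ p))
    sgn≋1 : sgn n ≋ 1ℤ
    sgn≋1 = begin
      sgn n        ≡⟨ sgn≡-1^ n ⟩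
      -1ℤ ^ n      ≈⟨ ^-congˡ n -1≋n ⟩
      (+ n) ^ n    ≈⟨ fermat (ℕD.>⇒∤ (ℕP.n<1+n n)) ⟩
      1ℤ           ∎

module PowerSums (q : ℕ) (p-prime : Prime (suc (suc q))) (r' : ℕ) where

  private
    p r : ℕ
    p = suc (suc q)
    r = suc r'
  open PrimeModulus q p-prime
  open ≋-Reasoning

  weight : ℕ → ℤ
  weight k = + invMod p (factorial k ℕ.^ r)

  powerSum : ℕ → ℤ
  powerSum n = sumℤ p (λ k → (+ k) ^ n * weight k)

  Dcomp≋powerSum : ∀ n → Dcomp r n p ≋ powerSum n
  Dcomp≋powerSum n = begin
    + (sumℕ p summand % p)
      ≈⟨ %-≋ (sumℕ p summand) ⟩
    + sumℕ p summand
      ≡⟨ pos-sumℕ p summand ⟩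
    sumℤ p (λ k → + summand k)
      ≡⟨ sumℤ-cong p (λ k _ → trans (ℤP.pos-* (k ℕ.^ n) _) (cong (_* weight k) (pos-^ k n))) ⟩
    powerSum n ∎
    where
    summand : ℕ → ℕ
    summand k = k ℕ.^ n ℕ.* invMod p (factorial k ℕ.^ r)

  weight-step : ∀ k → suc k < p → (+ suc k) ^ r * weight (suc k) ≋ weight k
  weight-step k 1+k<p = inverse-unique {x = + a} (begin
    + a * ((+ suc k) ^ r * w)
      ≡⟨ cong (λ y → + a * (y * w)) (pos-^ (suc k) r) ⟨
    + a * (+ (suc k ℕ.^ r) * w)
      ≡⟨ reassoc (+ a) (+ (suc k ℕ.^ r)) w ⟩
    + (suc k ℕ.^ r) * + a * w
      ≡⟨ cong (_* w) (ℤP.pos-* (suc k ℕ.^ r) a) ⟨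
    + (suc k ℕ.^ r ℕ.* a) * w
      ≡⟨ cong (λ y → + y * w) (^-distribʳ-* (suc k) (factorial k) r) ⟨
    + (factorial (suc k) ℕ.^ r) * w
      ≈⟨ invMod-inverse (∤-^ r (∤-factorial (suc k) 1+k<p)) ⟩
    1ℤ ∎)
    (invMod-inverse (∤-^ r (∤-factorial k (ℕP.<-trans (ℕP.n<1+n k) 1+k<p))))
    where
    a = factorial k ℕ.^ r
    w = weight (suc k)
    reassoc : ∀ x c y → x * (c * y) ≡ c * x * y
    reassoc = solve-∀

  weight-last : weight (suc q) ≋ sgn r
  weight-last = inverse-unique {x = + (factorial (suc q) ℕ.^ r)}
    (invMod-inverse (∤-^ r (∤-factorial (suc q) (ℕP.n<1+n (suc q)))))
    (begin
      + (factorial (suc q) ℕ.^ r) * sgn r     ≡⟨ cong (_* sgn r) (pos-^ (factorial (suc q)) r) ⟩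
      (+ factorial (suc q)) ^ r * sgn r       ≈⟨ *-congʳ (sgn r) (^-congˡ r wilson) ⟩
      -1ℤ ^ r * sgn r                         ≡⟨ cong (_* sgn r) (sgn≡-1^ r) ⟨
      sgn r * sgn r                           ≡⟨ sgn*sgn≡1 r ⟩
      1ℤ                                      ∎)

  boundary-term : ∀ m → - ((+ p) ^ m * weight (suc q)) ≋ forcing r m
  boundary-term zero    = begin
    - (1ℤ * weight (suc q))     ≡⟨ cong -_ (ℤP.*-identityˡ (weight (suc q))) ⟩
    - weight (suc q)            ≈⟨ -‿cong weight-last ⟩
    - - sgn r'                  ≡⟨ ℤP.neg-involutive (sgn r') ⟩
    sgn r'                      ∎
  boundary-term (suc m) = begin
    - (+ p * (+ p) ^ m * weight (suc q))    ≡⟨ reassoc (+ p) ((+ p) ^ m) (weight (suc q)) ⟩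
    - ((+ p) ^ m * weight (suc q)) * + p    ≈⟨ multiple≋0 (- ((+ p) ^ m * weight (suc q))) ⟩
    0ℤ                                      ∎
    where
    reassoc : ∀ x y w → - (x * y * w) ≡ - (y * w) * x
    reassoc = solve-∀

  powerSum-recurrence : ∀ m →
    powerSum (m ℕ.+ r) ≋ sumℤ (suc m) (λ i → + (m C i) * powerSum i) + forcing r m
  powerSum-recurrence m = begin
    sumℤ p (λ k → (+ k) ^ (m ℕ.+ r) * weight k)
      ≡⟨ sumℤ-head (suc q) _ ⟩
    (+ 0) ^ (m ℕ.+ r) * weight 0 + sumℤ (suc q) (λ j → (+ suc j) ^ (m ℕ.+ r) * weight (suc j))
      ≈⟨ +-cong (≋-reflexive zero-term) (sumℤ-cong-≋ (suc q) shift) ⟩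
    0ℤ + sumℤ (suc q) G
      ≡⟨ split-last (sumℤ (suc q) G) (G (suc q)) ⟩
    sumℤ p G + - G (suc q)
      ≡⟨ cong (_+ - G (suc q)) (sumℤ-shifted-powers p m weight) ⟩
    sumℤ (suc m) (λ i → + (m C i) * powerSum i) + - ((+ p) ^ m * weight (suc q))
      ≈⟨ +-congˡ (sumℤ (suc m) (λ i → + (m C i) * powerSum i)) (boundary-term m) ⟩
    sumℤ (suc m) (λ i → + (m C i) * powerSum i) + forcing r m ∎
    where
    G : ℕ → ℤ
    G j = (+ suc j) ^ m * weight j
    zero-term : (+ 0) ^ (m ℕ.+ r) * weight 0 ≡ 0ℤ
    zero-term = cong (_* weight 0) (trans (ℤP.^-distribˡ-+-* (+ 0) m r) (ℤP.*-zeroʳ ((+ 0) ^ m)))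
    shift : ∀ j → j < suc q → (+ suc j) ^ (m ℕ.+ r) * weight (suc j) ≋ G j
    shift j j<1+q = begin
      (+ suc j) ^ (m ℕ.+ r) * weight (suc j)
        ≡⟨ cong (_* weight (suc j)) (ℤP.^-distribˡ-+-* (+ suc j) m r) ⟩
      (+ suc j) ^ m * (+ suc j) ^ r * weight (suc j)
        ≡⟨ ℤP.*-assoc ((+ suc j) ^ m) ((+ suc j) ^ r) (weight (suc j)) ⟩
      (+ suc j) ^ m * ((+ suc j) ^ r * weight (suc j))
        ≈⟨ *-congˡ ((+ suc j) ^ m) (weight-step j (s≤s j<1+q)) ⟩
      G j ∎
    split-last : ∀ s x → 0ℤ + s ≡ s + x + - x
    split-last = solve-∀

  D-congruence : ∀ n → Dcomp r n p ≋ sumℤ r (λ j → + b r j n * Dcomp r j p) + g r n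
  D-congruence n = begin
    Dcomp r n p
      ≈⟨ Dcomp≋powerSum n ⟩
    powerSum n
      ≈⟨ Recurrence.represented (+ p) r' powerSum powerSum-recurrence n ⟩
    sumℤ r (λ j → + b r j n * powerSum j) + g r n
      ≈⟨ +-congʳ (g r n) (sumℤ-cong-≋ r (λ j _ → *-congˡ (+ b r j n) (≋-sym (Dcomp≋powerSum j)))) ⟩
    sumℤ r (λ j → + b r j n * Dcomp r j p) + g r n ∎

theorem1p3 : (r : ℕ) → 1 ≤ r → (n : ℕ) →
    D𝒜 r n ≈𝒜 (λ p → sumℤ r (λ j → (+ b r j n) * D𝒜 r j p) + g r n)
theorem1p3 (suc r') _ n = 1 , λ
  { zero          _     ()
  ; (suc zero)    _     (s≤s ())
  ; (suc (suc q)) p-prime _ → ∣⇒∣ᵤ (divides-difference (PowerSums.D-congruence q p-prime r' n))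
  }
  where open Congruence using (divides-difference)
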